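{- Let $W=\{1,\dots,n\}$ be a finite non-empty set of voters and let $\mathfrak{G}\subseteq\mathcal{P}(W)$ be a set of winning coalitions such that $W\in\mathfrak{G}$, $\emptyset\notin\mathfrak{G}$, and $\mathfrak{G}$ is monotone (if $A\in\mathfrak{G}$ and $A\subseteq B\subseteq W$ then $B\in\mathfrak{G}$). Let $\mathfrak{M}(\mathfrak{G})=\{V_1,\dots,V_m\}$ be the set of minimal winning coalitions, with $m=\#\mathfrak{M}(\mathfrak{G})$. For a voter $w\in W$ define the Banzhaf score $BS_w:=\#\{C\in\mathfrak{G}\mid w\in C,\ C\setminus\{w\}\notin\mathfrak{G}\}$. Then for each voter $w$, $$BS_w=\sum_{r=1}^m(-1)^{r-1}\sum_{1\leq i_1<\dots<i_r\leq m} t_{i_1,\dots,i_r}(w),$$ where $$t_{i_1,\dots,i_r}(w):=\begin{cases}2^{\,n-\#\bigcup_{j=1}^rV_{i_j}}, & \text{if } w\in\bigcup_{j=1}^rV_{i_j},\\ 0, & \text{if } w\notin\bigcup_{j=1}^rV_{i_j}.\end{cases}$$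
   Context: A coalition is a subset of $W$; $\mathcal{P}(W)$ is the power set of $W$ and $\#A$ denotes cardinality. A minimal winning coalition is a $V\in\mathfrak{G}$ such that $V\setminus\{i\}\notin\mathfrak{G}$ for every $i\in V$. -}

module Defs where

open import Data.Bool using (Bool; true; false; if_then_else_; _∧_; not)
open import Data.Nat using (ℕ; zero; suc; _∸_; _^_)
open import Data.Fin using (Fin)
open import Data.List using (List; []; _∷_; map; _++_; filter; length; upTo; allFin)
open import Data.Vec using (Vec; lookup)
open import Data.Fin.Subset using (Subset; inside; outside; _∈_; _-_; ⋃; ∣_∣)
open import Data.Fin.Subset.Properties using (_∈?_)
open import Data.Integer using (ℤ; +_; -_; _*_; _+_)
open import Data.Product using (_×_; ∃)
open import Relation.Binary.PropositionalEquality using (_≡_)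
open import Relation.Nullary.Decidable using (⌊_⌋)
open import Data.Nat.Properties using (_≟_)

allSubsets : (n : ℕ) → List (Subset n)
allSubsets zero    = Data.List.[ Data.Vec.[] ]
allSubsets (suc n) = map (inside Data.Vec.∷_) (allSubsets n) ++ map (outside Data.Vec.∷_) (allSubsets n)

Coalitions : ℕ → Set
Coalitions n = Subset n → Bool

IsMinimalWinning : {n : ℕ} → Coalitions n → Subset n → Set
IsMinimalWinning G V = (G V ≡ true) × (∀ i → i ∈ V → G (V - i) ≡ false)

_∈ᵇ_ : {n : ℕ} → Fin n → Subset n → Bool
w ∈ᵇ C = ⌊ w ∈? C ⌋

BS : {n : ℕ} → Coalitions n → Fin n → ℕ
BS {n} G w = length (filter (λ C → Data.Bool._≟_ (G C ∧ (w ∈ᵇ C) ∧ not (G (C - w))) true) (allSubsets n))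

unionOver : {n m : ℕ} → Vec (Subset n) m → Subset m → Subset n
unionOver {n} {m} Vs S = ⋃ (map (lookup Vs) (filter (_∈? S) (allFin m)))

t : {n m : ℕ} → Vec (Subset n) m → Subset m → Fin n → ℕ
t {n} Vs S w = if w ∈ᵇ unionOver Vs S then 2 ^ (n ∸ ∣ unionOver Vs S ∣) else 0

sumℤ : List ℤ → ℤ
sumℤ = Data.List.foldr _+_ (+ 0)

inclusionExclusion : {n m : ℕ} → Vec (Subset n) m → Fin n → ℤ
inclusionExclusion {n} {m} Vs w =
  sumℤ (map (λ r → (Data.Integer._^_ (- (+ 1)) (r ∸ 1)) *
                   sumℤ (map (λ S → + t Vs S w)
                             (filter (λ S → ∣ S ∣ ≟ r) (allSubsets m))))
            (map suc (upTo m)))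

-- Write U_S for the union of the V_i with i ∈ S. Every winning coalition contains a minimal one, so
-- [D ∈ 𝔊] = [∃ i, V_i ⊆ D] = ∑_{∅ ≠ S} (-1)^(|S|-1) [U_S ⊆ D] by inclusion–exclusion over index sets.
-- For w ∈ C, monotonicity makes [C is pivotal for w] = [C ∈ 𝔊] - [C ∖ {w} ∈ 𝔊], and termwise
-- [U_S ⊆ C] - [U_S ⊆ C ∖ {w}] = [w ∈ U_S] [U_S ⊆ C]. Summing over C, exactly 2^(n - |U_S|) coalitions
-- contain U_S; grouping the index sets S by their size r gives the formula.

module Submission where

open import Defs
open import Algebra.Bundles using (AbelianGroup)
open import Data.Bool using (Bool; true; false; _∧_; not; T)
import Data.Bool.Properties as Bool
open import Data.Empty using (⊥-elim)
open import Data.Fin using (Fin; zero; suc)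
open import Data.Fin.Properties using (any?)
open import Data.Fin.Subset
  using (Subset; inside; outside; _⊆_; ⊤; ⊥; _∈_; _∉_; ∣_∣; _─_; _-_; ⁅_⁆; ⋃; Nonempty)
open import Data.Fin.Subset.Properties
  using (_⊆?_; _∈?_; nonempty?; ∣p∣≤n; ∉⊥; x∈p∪q⁻; x∈p∪q⁺; x∈⁅x⁆; p─q⊆p;
         x∈p∧x≢y⇒x∈p-y; x∈p⇒∣p-x∣<∣p∣)
open import Data.Integer as ℤ using (ℤ; +_; -_; _+_; _*_; 0ℤ; 1ℤ; -1ℤ)
open import Data.Integer.Properties
open import Data.List using (List; []; _∷_; map; _++_; filter; length; upTo; allFin)
import Data.List.Properties as List
open import Data.List.Membership.Propositional using () renaming (_∈_ to _∈ₗ_)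
open import Data.List.Membership.Propositional.Properties
  using (∈-map⁺; ∈-map⁻; ∈-filter⁺; ∈-filter⁻; ∈-allFin)
import Data.List.Relation.Unary.Any as Any
open import Data.Nat as ℕ using (ℕ; zero; suc; _∸_; _^_; _≤_; _<_; s≤s)
import Data.Nat.Properties as ℕ
open import Data.Product using (∃; _×_; _,_; proj₁; proj₂)
open import Data.Sum using (_⊎_; inj₁; inj₂)
open import Data.Vec using (Vec; lookup; tabulate; _∷_; []; here; there)
open import Data.Vec.Properties using ([]=⇒lookup; lookup⇒[]=; lookup∘tabulate)
open import Function using (_∘_)
open import Function.Bundles using (_⇔_; mk⇔; Equivalence)
open import Function.Definitions using (Injective)
open import Relation.Binary.PropositionalEquality
open import Relation.Nullary using (yes; no; does; contradiction)
open import Relation.Nullary.Decidable using (does-⇔; dec-true; dec-false; _×-dec_; ¬?; T?)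
open import Relation.Unary using (Decidable)
open import Algebra.Properties.CommutativeSemigroup +-commutativeSemigroup using (interchange)
open import Algebra.Properties.Group (AbelianGroup.group +-0-abelianGroup) using (∙-cancelʳ)

private variable A B : Set

⟦_⟧ : Bool → ℤ
⟦ true ⟧  = 1ℤ
⟦ false ⟧ = 0ℤ

-- Defined through sumℤ so that inclusionExclusion unfolds definitionally into nested ∑'s.
∑ : List A → (A → ℤ) → ℤ
∑ xs f = sumℤ (map f xs)

infix 5 ∑
syntax ∑ xs (λ x → e) = ∑[ x ← xs ] e

∑-++ : ∀ (xs ys : List A) f → ∑ (xs ++ ys) f ≡ ∑ xs f + ∑ ys f
∑-++ []       ys f = sym (+-identityˡ _)
∑-++ (x ∷ xs) ys f = trans (cong (_+_ (f x)) (∑-++ xs ys f)) (sym (+-assoc (f x) _ _))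

∑-map : ∀ (g : B → A) xs f → ∑ (map g xs) f ≡ ∑ xs (f ∘ g)
∑-map g []       f = refl
∑-map g (x ∷ xs) f = cong (_+_ (f (g x))) (∑-map g xs f)

∑-cong : ∀ (xs : List A) {f g : A → ℤ} → (∀ x → f x ≡ g x) → ∑ xs f ≡ ∑ xs g
∑-cong []       f≗g = refl
∑-cong (x ∷ xs) f≗g = cong₂ _+_ (f≗g x) (∑-cong xs f≗g)

∑-zero : ∀ (xs : List A) → ∑[ x ← xs ] 0ℤ ≡ 0ℤ
∑-zero []       = refl
∑-zero (x ∷ xs) = trans (+-identityˡ _) (∑-zero xs)

∑-+ : ∀ (xs : List A) f g → ∑[ x ← xs ] (f x + g x) ≡ ∑ xs f + ∑ xs g
∑-+ []       f g = refl
∑-+ (x ∷ xs) f g = trans (cong (_+_ (f x + g x)) (∑-+ xs f g)) (interchange (f x) (g x) _ _)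

*-∑ : ∀ (xs : List A) c f → c * ∑ xs f ≡ ∑[ x ← xs ] (c * f x)
*-∑ []       c f = *-zeroʳ c
*-∑ (x ∷ xs) c f = trans (*-distribˡ-+ c (f x) _) (cong (_+_ (c * f x)) (*-∑ xs c f))

∑-* : ∀ (xs : List A) f c → ∑ xs f * c ≡ ∑[ x ← xs ] (f x * c)
∑-* xs f c = trans (*-comm (∑ xs f) c) (trans (*-∑ xs c f) (∑-cong xs (λ x → *-comm c (f x))))

∑-swap : ∀ (xs : List A) (ys : List B) (f : A → B → ℤ) →
         ∑[ x ← xs ] ∑[ y ← ys ] f x y ≡ ∑[ y ← ys ] ∑[ x ← xs ] f x y
∑-swap []       ys f = sym (∑-zero ys)
∑-swap (x ∷ xs) ys f =
  trans (cong (_+_ (∑ ys (f x))) (∑-swap xs ys f)) (sym (∑-+ ys (f x) (λ y → ∑[ x ← xs ] f x y)))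

∑-filter : ∀ {P : A → Set} (P? : Decidable P) xs f →
           ∑ (filter P? xs) f ≡ ∑[ x ← xs ] (⟦ does (P? x) ⟧ * f x)
∑-filter P? []       f = refl
∑-filter P? (x ∷ xs) f with does (P? x)
... | true  = cong₂ _+_ (sym (*-identityˡ (f x))) (∑-filter P? xs f)
... | false = trans (∑-filter P? xs f) (sym (+-identityˡ _))

length-filter : ∀ {P : A → Set} (P? : Decidable P) xs →
                + length (filter P? xs) ≡ ∑[ x ← xs ] ⟦ does (P? x) ⟧
length-filter P? []       = refl
length-filter P? (x ∷ xs) with does (P? x)
... | true  = cong (_+_ 1ℤ) (length-filter P? xs)
... | false = trans (length-filter P? xs) (sym (+-identityˡ _))

∑-upTo-suc : ∀ m (f : ℕ → ℤ) → ∑ (upTo (suc m)) f ≡ f 0 + (∑[ r ← upTo m ] f (suc r))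
∑-upTo-suc m f = cong (_+_ (f 0)) (trans (cong (λ rs → ∑ rs f) (sym (List.map-upTo suc m)))
                                       (∑-map suc (upTo m) f))

∑-upTo-≟ : ∀ {k m} → k < m → ∑[ r ← upTo m ] ⟦ does (k ℕ.≟ r) ⟧ ≡ 1ℤ
∑-upTo-≟ {zero}  {suc m} _ =
  trans (∑-upTo-suc m (λ r → ⟦ does (0 ℕ.≟ r) ⟧)) (cong (_+_ 1ℤ) (∑-zero (upTo m)))
∑-upTo-≟ {suc k} {suc m} (s≤s k<m) =
  trans (∑-upTo-suc m (λ r → ⟦ does (suc k ℕ.≟ r) ⟧)) (trans (+-identityˡ _) (∑-upTo-≟ k<m))

∑-allSubsets-suc : ∀ n (f : Subset (suc n) → ℤ) →
  ∑ (allSubsets (suc n)) f ≡ (∑[ S ← allSubsets n ] f (inside ∷ S)) + (∑[ S ← allSubsets n ] f (outside ∷ S))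
∑-allSubsets-suc n f = trans (∑-++ (map (inside ∷_) (allSubsets n)) _ f)
  (cong₂ _+_ (∑-map _ (allSubsets n) f) (∑-map _ (allSubsets n) f))

-1^_ : ℕ → ℤ
-1^ k = -1ℤ ℤ.^ k

-- Vanishing on the empty index set lets all S ⊆ {1,…,m} be summed over, not just the nonempty ones.
ieCoeff : ℕ → ℤ
ieCoeff zero    = 0ℤ
ieCoeff (suc k) = -1^ k

nonempty?-outside : ∀ {n} (T : Subset n) → does (nonempty? (outside ∷ T)) ≡ does (nonempty? T)
nonempty?-outside T = does-⇔
  (mk⇔ (λ { (suc i , there i∈T) → i , i∈T }) (λ (i , i∈T) → suc i , there i∈T))
  (nonempty? (outside ∷ T)) (nonempty? T)

∑-supersets : ∀ n (U : Subset n) → ∑[ C ← allSubsets n ] ⟦ does (U ⊆? C) ⟧ ≡ + (2 ^ (n ∸ ∣ U ∣))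
∑-supersets zero    []            = refl
∑-supersets (suc n) (inside ∷ U)  = trans (∑-allSubsets-suc n (λ C → ⟦ does (inside ∷ U ⊆? C) ⟧))
  (trans (cong₂ _+_ (∑-supersets n U) (∑-zero (allSubsets n))) (+-identityʳ _))
∑-supersets (suc n) (outside ∷ U) = trans (∑-allSubsets-suc n (λ C → ⟦ does (outside ∷ U ⊆? C) ⟧))
  (trans (cong₂ _+_ (∑-supersets n U) (∑-supersets n U)) doubling)
  where
  doubling : + (2 ^ (n ∸ ∣ U ∣)) + + (2 ^ (n ∸ ∣ U ∣)) ≡ + (2 ^ (suc n ∸ ∣ U ∣))
  doubling rewrite ℕ.+-∸-assoc 1 (∣p∣≤n U) =
    cong (λ x → + (2 ^ (n ∸ ∣ U ∣) ℕ.+ x)) (sym (ℕ.+-identityʳ _))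

∑-alternating-subsets : ∀ m (T : Subset m) →
  ∑[ S ← allSubsets m ] -1^ ∣ S ∣ * ⟦ does (S ⊆? T) ⟧ ≡ ⟦ not (does (nonempty? T)) ⟧
∑-alternating-subsets zero    []            = refl
∑-alternating-subsets (suc m) (inside ∷ T)  = begin
  ∑[ S ← allSubsets (suc m) ] -1^ ∣ S ∣ * ⟦ does (S ⊆? inside ∷ T) ⟧
    ≡⟨ ∑-allSubsets-suc m (λ S → -1^ ∣ S ∣ * ⟦ does (S ⊆? inside ∷ T) ⟧) ⟩
  (∑[ S ← allSubsets m ] -1^ (suc ∣ S ∣) * ⟦ does (S ⊆? T) ⟧) + X
    ≡⟨ cong (_+ X) (∑-cong (allSubsets m) (λ S → *-assoc -1ℤ (-1^ ∣ S ∣) _)) ⟩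
  (∑[ S ← allSubsets m ] -1ℤ * (-1^ ∣ S ∣ * ⟦ does (S ⊆? T) ⟧)) + X
    ≡⟨ cong (_+ X) (sym (*-∑ (allSubsets m) -1ℤ _)) ⟩
  -1ℤ * X + X
    ≡⟨ cong (_+ X) (-1*i≡-i X) ⟩
  - X + X
    ≡⟨ +-inverseˡ X ⟩
  0ℤ ∎
  where
  open ≡-Reasoning
  X = ∑[ S ← allSubsets m ] -1^ ∣ S ∣ * ⟦ does (S ⊆? T) ⟧
∑-alternating-subsets (suc m) (outside ∷ T) =
  trans (∑-allSubsets-suc m (λ S → -1^ ∣ S ∣ * ⟦ does (S ⊆? outside ∷ T) ⟧))
  (trans (cong₂ _+_ (∑-cong (allSubsets m) (λ S → *-zeroʳ (-1^ (suc ∣ S ∣)))) (∑-alternating-subsets m T))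
  (trans (cong₂ _+_ (∑-zero (allSubsets m)) (cong (⟦_⟧ ∘ not) (sym (nonempty?-outside T))))
         (+-identityˡ _)))

∑-ieCoeff-subsets : ∀ m (T : Subset m) →
  ∑[ S ← allSubsets m ] ieCoeff ∣ S ∣ * ⟦ does (S ⊆? T) ⟧ ≡ ⟦ does (nonempty? T) ⟧
∑-ieCoeff-subsets zero    []            = refl
∑-ieCoeff-subsets (suc m) (inside ∷ T)  =
  trans (∑-allSubsets-suc m (λ S → ieCoeff ∣ S ∣ * ⟦ does (S ⊆? inside ∷ T) ⟧))
  (trans (cong₂ _+_ (∑-alternating-subsets m T) (∑-ieCoeff-subsets m T)) (complement (does (nonempty? T))))
  where
  complement : ∀ b → ⟦ not b ⟧ + ⟦ b ⟧ ≡ 1ℤ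
  complement true  = refl
  complement false = refl
∑-ieCoeff-subsets (suc m) (outside ∷ T) =
  trans (∑-allSubsets-suc m (λ S → ieCoeff ∣ S ∣ * ⟦ does (S ⊆? outside ∷ T) ⟧))
  (trans (cong₂ _+_ (∑-cong (allSubsets m) (λ S → *-zeroʳ (-1^ ∣ S ∣))) (∑-ieCoeff-subsets m T))
  (trans (cong₂ _+_ (∑-zero (allSubsets m)) (cong ⟦_⟧ (sym (nonempty?-outside T))))
         (+-identityˡ _)))

∈⋃⁻ : ∀ {n} (ps : List (Subset n)) {x} → x ∈ ⋃ ps → ∃ λ p → p ∈ₗ ps × x ∈ p
∈⋃⁻ []       x∈ = ⊥-elim (∉⊥ x∈)
∈⋃⁻ (p ∷ ps) x∈ with x∈p∪q⁻ p (⋃ ps) x∈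
... | inj₁ x∈p = p , Any.here refl , x∈p
... | inj₂ x∈⋃ps with ∈⋃⁻ ps x∈⋃ps
...   | q , q∈ps , x∈q = q , Any.there q∈ps , x∈q

∈⋃⁺ : ∀ {n} (ps : List (Subset n)) {x p} → p ∈ₗ ps → x ∈ p → x ∈ ⋃ ps
∈⋃⁺ (q ∷ ps) (Any.here refl) x∈p = x∈p∪q⁺ (inj₁ x∈p)
∈⋃⁺ (q ∷ ps) (Any.there p∈) x∈p = x∈p∪q⁺ {p = q} (inj₂ (∈⋃⁺ ps p∈ x∈p))

module _ {n m : ℕ} (Vs : Vec (Subset n) m) where

  ∈-unionOver⁻ : ∀ S {x} → x ∈ unionOver Vs S → ∃ λ i → i ∈ S × x ∈ lookup Vs i
  ∈-unionOver⁻ S x∈ with ∈⋃⁻ (map (lookup Vs) (filter (_∈? S) (allFin m))) x∈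
  ... | p , p∈ , x∈p with ∈-map⁻ (lookup Vs) p∈
  ...   | i , i∈ , refl = i , proj₂ (∈-filter⁻ (_∈? S) {xs = allFin m} i∈) , x∈p

  ∈-unionOver⁺ : ∀ S {x} i → i ∈ S → x ∈ lookup Vs i → x ∈ unionOver Vs S
  ∈-unionOver⁺ S i i∈S = ∈⋃⁺ (map (lookup Vs) (filter (_∈? S) (allFin m)))
    (∈-map⁺ (lookup Vs) (∈-filter⁺ (_∈? S) (∈-allFin i) i∈S))

  indicesBelow : Subset n → Subset m
  indicesBelow D = tabulate (λ i → does (lookup Vs i ⊆? D))

  ∈-indicesBelow⁻ : ∀ D i → i ∈ indicesBelow D → lookup Vs i ⊆ D
  ∈-indicesBelow⁻ D i i∈ with lookup Vs i ⊆? D | trans (sym (lookup∘tabulate _ i)) ([]=⇒lookup i∈)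
  ... | yes Vᵢ⊆D | _ = Vᵢ⊆D

  ∈-indicesBelow⁺ : ∀ D i → lookup Vs i ⊆ D → i ∈ indicesBelow D
  ∈-indicesBelow⁺ D i Vᵢ⊆D = lookup⇒[]= i (indicesBelow D)
    (trans (lookup∘tabulate _ i) (dec-true (lookup Vs i ⊆? D) Vᵢ⊆D))

  unionOver-⊆⇔ : ∀ S D → (unionOver Vs S ⊆ D) ⇔ (S ⊆ indicesBelow D)
  unionOver-⊆⇔ S D = mk⇔ {A = unionOver Vs S ⊆ D} {B = S ⊆ indicesBelow D}
    (λ U⊆D {i} i∈S → ∈-indicesBelow⁺ D i (λ x∈ → U⊆D (∈-unionOver⁺ S i i∈S x∈)))
    (λ S⊆I x∈ → let i , i∈S , x∈Vᵢ = ∈-unionOver⁻ S x∈ in ∈-indicesBelow⁻ D i (S⊆I i∈S) x∈Vᵢ)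

x∈p─q⇒x∉q : ∀ {n} (p q : Subset n) {x} → x ∈ p ─ q → x ∉ q
x∈p─q⇒x∉q (_ ∷ p) (inside  ∷ q) {zero}  ()          here
x∈p─q⇒x∉q (_ ∷ p) (outside ∷ q) {zero}  _           ()
x∈p─q⇒x∉q (_ ∷ p) (_       ∷ q) {suc x} (there x∈) (there x∈q) = x∈p─q⇒x∉q p q x∈ x∈q

⊆-remove⇔ : ∀ {n} (U C : Subset n) w → (U ⊆ C - w) ⇔ (U ⊆ C × w ∉ U)
⊆-remove⇔ U C w = mk⇔ {A = U ⊆ C - w} {B = U ⊆ C × w ∉ U}
  (λ U⊆C-w → (λ x∈ → p─q⊆p C ⁅ w ⁆ (U⊆C-w x∈)) , (λ w∈U → x∈p─q⇒x∉q C ⁅ w ⁆ (U⊆C-w w∈U) (x∈⁅x⁆ w)))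
  (λ (U⊆C , w∉U) x∈ → x∈p∧x≢y⇒x∈p-y (U⊆C x∈) (λ { refl → w∉U x∈ }))

does-⊆?-remove : ∀ {n} (U C : Subset n) w →
  does (U ⊆? C - w) ≡ does (U ⊆? C) ∧ not (does (w ∈? U))
does-⊆?-remove U C w = does-⇔ (⊆-remove⇔ U C w) (U ⊆? C - w) ((U ⊆? C) ×-dec ¬? (w ∈? U))

⟦⟧-split : ∀ a b → ⟦ a ⟧ ≡ ⟦ b ⟧ * ⟦ a ⟧ + ⟦ a ∧ not b ⟧
⟦⟧-split true  true  = refl
⟦⟧-split true  false = refl
⟦⟧-split false true  = refl
⟦⟧-split false false = refl

⟦⟧-split-⇒ : ∀ a b → (b ≡ true → a ≡ true) → ⟦ a ⟧ ≡ ⟦ a ∧ not b ⟧ + ⟦ b ⟧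
⟦⟧-split-⇒ true  true  _   = refl
⟦⟧-split-⇒ true  false _   = refl
⟦⟧-split-⇒ false true  b⇒a = contradiction (b⇒a refl) (λ ())
⟦⟧-split-⇒ false false _   = refl

⟦_∈_⊆_⟧ : ∀ {n} → Fin n → Subset n → Subset n → ℤ
⟦ w ∈ V ⊆ C ⟧ = ⟦ does (w ∈? V) ⟧ * ⟦ does (V ⊆? C) ⟧

module _ {n m : ℕ} {G : Coalitions n} {Vs : Vec (Subset n) m}
         (minimal⇔ : ∀ V → IsMinimalWinning G V ⇔ ∃ (λ i → lookup Vs i ≡ V)) where

  minimal⊎shrinkable : ∀ D → G D ≡ true →
    IsMinimalWinning G D ⊎ ∃ λ i → i ∈ D × G (D - i) ≡ true
  minimal⊎shrinkable D GD with any? (λ i → (i ∈? D) ×-dec (G (D - i) Bool.≟ true))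
  ... | yes shrink = inj₂ shrink
  ... | no ¬shrink = inj₁ (GD , λ i i∈D → Bool.¬-not (λ G[D-i] → ¬shrink (i , i∈D , G[D-i])))

  winning⇒⊇minimal : ∀ D → G D ≡ true → ∃ λ i → lookup Vs i ⊆ D
  winning⇒⊇minimal D = descend (suc ∣ D ∣) D (ℕ.n<1+n ∣ D ∣)
    where
    descend : ∀ k D → ∣ D ∣ < k → G D ≡ true → ∃ λ i → lookup Vs i ⊆ D
    descend (suc k) D (s≤s ∣D∣≤k) GD with minimal⊎shrinkable D GD
    ... | inj₁ minimal = let i , Vᵢ≡D = Equivalence.to (minimal⇔ D) minimal
                         in i , λ x∈ → subst (_ ∈_) Vᵢ≡D x∈
    ... | inj₂ (j , j∈D , G[D-j]) =
      let i , Vᵢ⊆D-j = descend k (D - j) (ℕ.<-≤-trans (x∈p⇒∣p-x∣<∣p∣ j∈D) ∣D∣≤k) G[D-j]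
      in i , λ x∈ → p─q⊆p D ⁅ j ⁆ (Vᵢ⊆D-j x∈)

  module _ (mono : ∀ A B → A ⊆ B → G A ≡ true → G B ≡ true) where

    ⊇minimal⇒winning : ∀ D i → lookup Vs i ⊆ D → G D ≡ true
    ⊇minimal⇒winning D i Vᵢ⊆D =
      mono (lookup Vs i) D Vᵢ⊆D (proj₁ (Equivalence.from (minimal⇔ (lookup Vs i)) (i , refl)))

    G≡nonempty? : ∀ D → G D ≡ does (nonempty? (indicesBelow Vs D))
    G≡nonempty? D = does-⇔ winning⇔nonempty (T? (G D)) (nonempty? (indicesBelow Vs D))
      where
      winning⇔nonempty : T (G D) ⇔ Nonempty (indicesBelow Vs D)
      winning⇔nonempty = mk⇔
        (λ GD → let i , Vᵢ⊆D = winning⇒⊇minimal D (Equivalence.to Bool.T-≡ GD)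
                in i , ∈-indicesBelow⁺ Vs D i Vᵢ⊆D)
        (λ (i , i∈) → Equivalence.from Bool.T-≡ (⊇minimal⇒winning D i (∈-indicesBelow⁻ Vs D i i∈)))

    ⟦G⟧≡∑ : ∀ D → ⟦ G D ⟧ ≡ ∑[ S ← allSubsets m ] ieCoeff ∣ S ∣ * ⟦ does (unionOver Vs S ⊆? D) ⟧
    ⟦G⟧≡∑ D = begin
      ⟦ G D ⟧
        ≡⟨ cong ⟦_⟧ (G≡nonempty? D) ⟩
      ⟦ does (nonempty? (indicesBelow Vs D)) ⟧
        ≡⟨ sym (∑-ieCoeff-subsets m (indicesBelow Vs D)) ⟩
      ∑[ S ← allSubsets m ] ieCoeff ∣ S ∣ * ⟦ does (S ⊆? indicesBelow Vs D) ⟧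
        ≡⟨ ∑-cong (allSubsets m) (λ S → cong (λ b → ieCoeff ∣ S ∣ * ⟦ b ⟧)
             (sym (does-⇔ (unionOver-⊆⇔ Vs S D) (unionOver Vs S ⊆? D) (S ⊆? indicesBelow Vs D)))) ⟩
      ∑[ S ← allSubsets m ] ieCoeff ∣ S ∣ * ⟦ does (unionOver Vs S ⊆? D) ⟧ ∎
      where open ≡-Reasoning

    ⟦pivotal⟧≡∑ : ∀ w C →
      ⟦ G C ∧ (w ∈ᵇ C) ∧ not (G (C - w)) ⟧ ≡
      ∑[ S ← allSubsets m ] ieCoeff ∣ S ∣ * ⟦ w ∈ unionOver Vs S ⊆ C ⟧
    ⟦pivotal⟧≡∑ w C with w ∈? C
    -- ⟦ G C ⟧ is both ⟦pivotal⟧ + ⟦ G (C - w) ⟧ (monotonicity) and X + ⟦ G (C - w) ⟧ (inclusion–exclusion).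
    ... | yes w∈C = ∙-cancelʳ ⟦ G (C - w) ⟧ _ _ (begin
      ⟦ G C ∧ not (G (C - w)) ⟧ + ⟦ G (C - w) ⟧
        ≡⟨ sym (⟦⟧-split-⇒ (G C) (G (C - w)) (mono (C - w) C (p─q⊆p C ⁅ w ⁆))) ⟩
      ⟦ G C ⟧
        ≡⟨ ⟦G⟧≡∑ C ⟩
      ∑[ S ← allSubsets m ] ieCoeff ∣ S ∣ * ⟦ does (U S ⊆? C) ⟧
        ≡⟨ ∑-cong (allSubsets m) (λ S → splitTerm {∣ S ∣} (U S)) ⟩
      ∑[ S ← allSubsets m ] (ieCoeff ∣ S ∣ * ⟦ w ∈ U S ⊆ C ⟧ + ieCoeff ∣ S ∣ * ⟦ does (U S ⊆? C - w) ⟧)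
        ≡⟨ ∑-+ (allSubsets m) _ _ ⟩
      X + (∑[ S ← allSubsets m ] ieCoeff ∣ S ∣ * ⟦ does (U S ⊆? C - w) ⟧)
        ≡⟨ cong (_+_ X) (sym (⟦G⟧≡∑ (C - w))) ⟩
      X + ⟦ G (C - w) ⟧ ∎)
      where
      open ≡-Reasoning
      U = unionOver Vs
      X = ∑[ S ← allSubsets m ] ieCoeff ∣ S ∣ * ⟦ w ∈ U S ⊆ C ⟧
      splitTerm : ∀ {k} V → ieCoeff k * ⟦ does (V ⊆? C) ⟧ ≡ ieCoeff k * ⟦ w ∈ V ⊆ C ⟧ + ieCoeff k * ⟦ does (V ⊆? C - w) ⟧
      splitTerm {k} V = begin
        ieCoeff k * ⟦ does (V ⊆? C) ⟧
          ≡⟨ cong (ieCoeff k *_) (⟦⟧-split (does (V ⊆? C)) (does (w ∈? V))) ⟩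
        ieCoeff k * (⟦ w ∈ V ⊆ C ⟧ + ⟦ does (V ⊆? C) ∧ not (does (w ∈? V)) ⟧)
          ≡⟨ cong (λ b → ieCoeff k * (⟦ w ∈ V ⊆ C ⟧ + ⟦ b ⟧)) (sym (does-⊆?-remove V C w)) ⟩
        ieCoeff k * (⟦ w ∈ V ⊆ C ⟧ + ⟦ does (V ⊆? C - w) ⟧)
          ≡⟨ *-distribˡ-+ (ieCoeff k) _ _ ⟩
        ieCoeff k * ⟦ w ∈ V ⊆ C ⟧ + ieCoeff k * ⟦ does (V ⊆? C - w) ⟧ ∎
    ... | no w∉C = begin
      ⟦ G C ∧ false ⟧
        ≡⟨ cong ⟦_⟧ (Bool.∧-zeroʳ (G C)) ⟩
      0ℤ
        ≡⟨ sym (∑-zero (allSubsets m)) ⟩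
      ∑[ S ← allSubsets m ] 0ℤ
        ≡⟨ ∑-cong (allSubsets m) (λ S → sym (trans (cong (ieCoeff ∣ S ∣ *_) (⟦∈⊆⟧≡0 (unionOver Vs S)))
                                                   (*-zeroʳ (ieCoeff ∣ S ∣)))) ⟩
      ∑[ S ← allSubsets m ] ieCoeff ∣ S ∣ * ⟦ w ∈ unionOver Vs S ⊆ C ⟧ ∎
      where
      open ≡-Reasoning
      ⟦∈⊆⟧≡0 : ∀ V → ⟦ w ∈ V ⊆ C ⟧ ≡ 0ℤ
      ⟦∈⊆⟧≡0 V with w ∈? V | V ⊆? C
      ... | yes w∈V | yes V⊆C = contradiction (V⊆C w∈V) w∉C
      ... | yes _   | no _    = refl
      ... | no _    | _       = refl

∑-groupBySize : ∀ {m} (size : A → ℕ) → (∀ x → size x ≤ m) → ∀ xs (f : A → ℤ) →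
  ∑[ r ← map suc (upTo m) ] -1^ (r ∸ 1) * (∑[ x ← filter (λ x → size x ℕ.≟ r) xs ] f x)
    ≡ ∑[ x ← xs ] ieCoeff (size x) * f x
∑-groupBySize {m = m} size size≤m xs f = begin
  _ ≡⟨ ∑-map suc (upTo m) _ ⟩
  ∑[ r ← upTo m ] -1^ r * (∑[ x ← filter (λ x → size x ℕ.≟ suc r) xs ] f x)
    ≡⟨ ∑-cong (upTo m) (λ r → trans (*-∑ (filter (λ x → size x ℕ.≟ suc r) xs) (-1^ r) f) (∑-filter _ xs _)) ⟩
  ∑[ r ← upTo m ] ∑[ x ← xs ] ⟦ does (size x ℕ.≟ suc r) ⟧ * (-1^ r * f x)
    ≡⟨ ∑-swap (upTo m) xs _ ⟩
  ∑[ x ← xs ] ∑[ r ← upTo m ] ⟦ does (size x ℕ.≟ suc r) ⟧ * (-1^ r * f x)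
    ≡⟨ ∑-cong xs (λ x → select (size x) (size≤m x) (f x)) ⟩
  ∑[ x ← xs ] ieCoeff (size x) * f x ∎
  where
  open ≡-Reasoning
  select : ∀ k → k ≤ m → ∀ a → ∑[ r ← upTo m ] ⟦ does (k ℕ.≟ suc r) ⟧ * (-1^ r * a) ≡ ieCoeff k * a
  select zero    _   a = ∑-zero (upTo m)
  select (suc k) k<m a = begin
    ∑[ r ← upTo m ] ⟦ does (k ℕ.≟ r) ⟧ * (-1^ r * a)
      ≡⟨ ∑-cong (upTo m) onDiagonal ⟩
    ∑[ r ← upTo m ] ⟦ does (k ℕ.≟ r) ⟧ * (-1^ k * a)
      ≡⟨ sym (∑-* (upTo m) _ (-1^ k * a)) ⟩
    (∑[ r ← upTo m ] ⟦ does (k ℕ.≟ r) ⟧) * (-1^ k * a)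
      ≡⟨ cong (_* (-1^ k * a)) (∑-upTo-≟ k<m) ⟩
    1ℤ * (-1^ k * a)
      ≡⟨ *-identityˡ _ ⟩
    -1^ k * a ∎
    where
    onDiagonal : ∀ r → ⟦ does (k ℕ.≟ r) ⟧ * (-1^ r * a) ≡ ⟦ does (k ℕ.≟ r) ⟧ * (-1^ k * a)
    onDiagonal r with k ℕ.≟ r
    ... | yes refl = refl
    ... | no k≢r rewrite dec-false (k ℕ.≟ r) k≢r = refl

t≡∑ : ∀ {n m} (Vs : Vec (Subset n) m) S w →
  + t Vs S w ≡ ∑[ C ← allSubsets n ] ⟦ w ∈ unionOver Vs S ⊆ C ⟧
t≡∑ {n} Vs S w with w ∈? unionOver Vs S
... | yes _ = trans (sym (∑-supersets n (unionOver Vs S))) (∑-cong (allSubsets n) (λ C → sym (*-identityˡ _)))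
... | no _  = sym (∑-zero (allSubsets n))

does-≟-true : ∀ b → does (b Bool.≟ true) ≡ b
does-≟-true true  = refl
does-≟-true false = refl

theorem1 : (n : ℕ) → 1 ≤ n →
           (G : Coalitions n) →
           G ⊤ ≡ true →
           G ⊥ ≡ false →
           (∀ A B → A ⊆ B → G A ≡ true → G B ≡ true) →
           (m : ℕ) (Vs : Vec (Subset n) m) →
           Injective _≡_ _≡_ (lookup Vs) →
           (∀ V → IsMinimalWinning G V ⇔ ∃ (λ i → lookup Vs i ≡ V)) →
           (w : Fin n) →
           + BS G w ≡ inclusionExclusion Vs w
theorem1 n _ G _ _ mono m Vs _ minimal⇔ w = begin
  + BS G w
    ≡⟨ length-filter _ (allSubsets n) ⟩
  ∑[ C ← allSubsets n ] ⟦ does ((G C ∧ (w ∈ᵇ C) ∧ not (G (C - w))) Bool.≟ true) ⟧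
    ≡⟨ ∑-cong (allSubsets n) (λ C → trans (cong ⟦_⟧ (does-≟-true (G C ∧ (w ∈ᵇ C) ∧ not (G (C - w)))))
                                          (⟦pivotal⟧≡∑ {Vs = Vs} minimal⇔ mono w C)) ⟩
  ∑[ C ← allSubsets n ] ∑[ S ← allSubsets m ] ieCoeff ∣ S ∣ * ⟦ w ∈ unionOver Vs S ⊆ C ⟧
    ≡⟨ ∑-swap (allSubsets n) (allSubsets m) _ ⟩
  ∑[ S ← allSubsets m ] ∑[ C ← allSubsets n ] ieCoeff ∣ S ∣ * ⟦ w ∈ unionOver Vs S ⊆ C ⟧
    ≡⟨ ∑-cong (allSubsets m) (λ S → trans (sym (*-∑ (allSubsets n) (ieCoeff ∣ S ∣) _))
                                          (cong (ieCoeff ∣ S ∣ *_) (sym (t≡∑ Vs S w)))) ⟩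
  ∑[ S ← allSubsets m ] ieCoeff ∣ S ∣ * + t Vs S w
    ≡⟨ sym (∑-groupBySize ∣_∣ ∣p∣≤n (allSubsets m) (λ S → + t Vs S w)) ⟩
  inclusionExclusion Vs w ∎
  where open ≡-Reasoning
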